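{- Let $\mathbf f:\mathbb{N}^{p+1}\to\mathbb{Z}^d$ and $\mathbf h$ be functions such that for all $x,\mathbf y$, $$\mathbf f(x+1,\mathbf y)=\mathbf f(x,\mathbf y)+(|x+1|-|x|)\cdot\mathbf h(\mathbf f(x,\mathbf y),x,\mathbf y).$$ Then for all $x,\mathbf y$, $$\mathbf f(x,\mathbf y)=\mathbf f(0,\mathbf y)+\sum_{i=0}^{|x|-1}\mathbf h(\mathbf f(2^i-1,\mathbf y),2^i-1,\mathbf y).$$
   Context: For $x\in\mathbb{N}$, $|x|$ denotes the length of the binary representation of $x$, with $|0|=0$. -}

module Defs where

open import Data.Nat using (ℕ; zero; suc; ⌊_/2⌋)
open import Data.Integer using (ℤ; +_; _+_; _*_)
open import Data.Vec using (Vec; zipWith; map; replicate)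

bitLen' : ℕ → ℕ → ℕ
bitLen' zero    _       = 0
bitLen' (suc k) zero    = 0
bitLen' (suc k) (suc n) = suc (bitLen' k ⌊ suc n /2⌋)

-- |x| : length of the binary representation of x, with |0| = 0.
-- (fuel x suffices since x halvings reach 0)
∣_∣ᵇ : ℕ → ℕ
∣ x ∣ᵇ = bitLen' x x

_+ᵥ_ : ∀ {d} → Vec ℤ d → Vec ℤ d → Vec ℤ d
u +ᵥ v = zipWith _+_ u v

_·ᵥ_ : ∀ {d} → ℤ → Vec ℤ d → Vec ℤ d
k ·ᵥ v = map (k *_) v

vsum : ∀ {d} → ℕ → (ℕ → Vec ℤ d) → Vec ℤ d
vsum zero    g = replicate _ (+ 0)
vsum (suc n) g = vsum n g +ᵥ g n

module Submission where

-- |x + 1| − |x| is 0 unless x + 1 is a power of two, where it is 1; at such a jump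
-- x = 2^i − 1 with i = |x|.  So f only moves, by h, at the points 2^i − 1 with i < |x|,
-- and the recurrence telescopes to the stated sum.  The jump criterion comes from the
-- characterisation of |x| as the unique k with x < 2^k ≤ 2x (for x > 0).

open import Defs
open import Data.Nat using (ℕ; zero; suc; _^_; _∸_; _*_; _≤_; _<_; ⌊_/2⌋; z≤n; s≤s; z<s; s<s)
open import Data.Nat.Properties
  using (≤-refl; ≤-trans; ≤-reflexive; ≤-antisym; <-≤-trans; <⇒≱; ≮⇒≥; n≤1+n; m<m+n; m≤n⇒m<n∨m≡n;
         *-suc; *-monoʳ-≤; *-cancelˡ-≤; ^-monoʳ-≤; m^n>0; m+n∸n≡m; ⌊n/2⌋≤n; ⌈n/2⌉≤n)
open import Data.Integer using (ℤ; +_; _-_; 0ℤ; 1ℤ)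
import Data.Integer.Properties as ℤ
open import Data.Vec using (Vec; replicate)
open import Data.Vec.Properties using (zipWith-assoc; zipWith-identityʳ; map-cong; map-const; map-id)
open import Data.Sum using (inj₁; inj₂)
open import Function using (_∘_)
open import Relation.Binary.PropositionalEquality using (_≡_; refl; sym; trans; cong; cong₂; module ≡-Reasoning)

private
  variable
    d : ℕ

+ᵥ-identityʳ : (v : Vec ℤ d) → v +ᵥ replicate d 0ℤ ≡ v
+ᵥ-identityʳ = zipWith-identityʳ ℤ.+-identityʳ

+ᵥ-assoc : (u v w : Vec ℤ d) → (u +ᵥ v) +ᵥ w ≡ u +ᵥ (v +ᵥ w)
+ᵥ-assoc = zipWith-assoc ℤ.+-assoc

·ᵥ-zeroˡ : (v : Vec ℤ d) → 0ℤ ·ᵥ v ≡ replicate d 0ℤ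
·ᵥ-zeroˡ v = trans (map-cong ℤ.*-zeroˡ v) (map-const v 0ℤ)

·ᵥ-identityˡ : (v : Vec ℤ d) → 1ℤ ·ᵥ v ≡ v
·ᵥ-identityˡ v = trans (map-cong ℤ.*-identityˡ v) (map-id v)

[1+n]-n≡1 : ∀ n → + suc n - + n ≡ 1ℤ
[1+n]-n≡1 n = trans (ℤ.[+m]-[+n]≡m⊖n (suc n) n) (trans (ℤ.⊖-≥ (n≤1+n n)) (cong +_ (m+n∸n≡m 1 n)))

+ᵥ-[m-n]·ᵥ-same : ∀ {m n} (v w : Vec ℤ d) → m ≡ n → v +ᵥ ((+ m - + n) ·ᵥ w) ≡ v
+ᵥ-[m-n]·ᵥ-same {n = n} v w refl = begin
  v +ᵥ ((+ n - + n) ·ᵥ w)  ≡⟨ cong (λ c → v +ᵥ (c ·ᵥ w)) (ℤ.+-inverseʳ (+ n)) ⟩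
  v +ᵥ (0ℤ ·ᵥ w)           ≡⟨ cong (v +ᵥ_) (·ᵥ-zeroˡ w) ⟩
  v +ᵥ replicate _ 0ℤ      ≡⟨ +ᵥ-identityʳ v ⟩
  v                        ∎
  where open ≡-Reasoning

+ᵥ-[m-n]·ᵥ-suc : ∀ {m n} (v w : Vec ℤ d) → m ≡ suc n → v +ᵥ ((+ m - + n) ·ᵥ w) ≡ v +ᵥ w
+ᵥ-[m-n]·ᵥ-suc {n = n} v w refl = begin
  v +ᵥ ((+ suc n - + n) ·ᵥ w)  ≡⟨ cong (λ c → v +ᵥ (c ·ᵥ w)) ([1+n]-n≡1 n) ⟩
  v +ᵥ (1ℤ ·ᵥ w)               ≡⟨ cong (v +ᵥ_) (·ᵥ-identityˡ w) ⟩
  v +ᵥ w                       ∎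
  where open ≡-Reasoning

data LadderStep (L rung : ℕ → ℕ) (x : ℕ) : Set where
  stay  : L (suc x) ≡ L x → LadderStep L rung x
  climb : L (suc x) ≡ suc (L x) → x ≡ rung (L x) → LadderStep L rung x

module _ {L rung : ℕ → ℕ} (L0≡0 : L 0 ≡ 0) (step : ∀ x → LadderStep L rung x) where

  telescope-ladder : (a g : ℕ → Vec ℤ d) →
    (∀ x → a (suc x) ≡ a x +ᵥ ((+ L (suc x) - + L x) ·ᵥ g x)) →
    ∀ x → a x ≡ a 0 +ᵥ vsum (L x) (g ∘ rung)
  telescope-ladder a g rec zero = begin
    a 0                                ≡⟨ sym (+ᵥ-identityʳ (a 0)) ⟩
    a 0 +ᵥ vsum 0 (g ∘ rung)           ≡⟨ cong (λ n → a 0 +ᵥ vsum n (g ∘ rung)) (sym L0≡0) ⟩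
    a 0 +ᵥ vsum (L 0) (g ∘ rung)       ∎
    where open ≡-Reasoning
  telescope-ladder a g rec (suc x) with step x
  ... | stay e = begin
    a (suc x)                              ≡⟨ rec x ⟩
    a x +ᵥ ((+ L (suc x) - + L x) ·ᵥ g x)  ≡⟨ +ᵥ-[m-n]·ᵥ-same (a x) (g x) e ⟩
    a x                                    ≡⟨ telescope-ladder a g rec x ⟩
    a 0 +ᵥ vsum (L x) (g ∘ rung)           ≡⟨ cong (λ n → a 0 +ᵥ vsum n (g ∘ rung)) (sym e) ⟩
    a 0 +ᵥ vsum (L (suc x)) (g ∘ rung)     ∎
    where open ≡-Reasoning
  ... | climb e x≡rung = begin
    a (suc x)                                         ≡⟨ rec x ⟩
    a x +ᵥ ((+ L (suc x) - + L x) ·ᵥ g x)             ≡⟨ +ᵥ-[m-n]·ᵥ-suc (a x) (g x) e ⟩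
    a x +ᵥ g x                                        ≡⟨ cong₂ _+ᵥ_ (telescope-ladder a g rec x) (cong g x≡rung) ⟩
    (a 0 +ᵥ vsum (L x) (g ∘ rung)) +ᵥ g (rung (L x))  ≡⟨ +ᵥ-assoc (a 0) _ _ ⟩
    a 0 +ᵥ vsum (suc (L x)) (g ∘ rung)                ≡⟨ cong (λ n → a 0 +ᵥ vsum n (g ∘ rung)) (sym e) ⟩
    a 0 +ᵥ vsum (L (suc x)) (g ∘ rung)                ∎
    where open ≡-Reasoning

2*⌊n/2⌋≤n : ∀ n → 2 * ⌊ n /2⌋ ≤ n
2*⌊n/2⌋≤n zero          = z≤n
2*⌊n/2⌋≤n (suc zero)    = z≤n
2*⌊n/2⌋≤n (suc (suc n)) = ≤-trans (≤-reflexive (*-suc 2 ⌊ n /2⌋)) (s≤s (s≤s (2*⌊n/2⌋≤n n)))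

n<2*[1+⌊n/2⌋] : ∀ n → n < 2 * suc ⌊ n /2⌋
n<2*[1+⌊n/2⌋] zero          = z<s
n<2*[1+⌊n/2⌋] (suc zero)    = s<s z<s
n<2*[1+⌊n/2⌋] (suc (suc n)) = <-≤-trans (s<s (s<s (n<2*[1+⌊n/2⌋] n))) (≤-reflexive (sym (*-suc 2 (suc ⌊ n /2⌋))))

bitLen'-upper : ∀ {k n} → n ≤ k → n < 2 ^ bitLen' k n
bitLen'-upper {k} {zero}      _         = m^n>0 2 (bitLen' k 0)
bitLen'-upper {suc k} {suc n} (s≤s n≤k) =
  <-≤-trans (n<2*[1+⌊n/2⌋] (suc n)) (*-monoʳ-≤ 2 (bitLen'-upper (≤-trans (⌈n/2⌉≤n n) n≤k)))

bitLen'-lower : ∀ {k n} → suc n ≤ k → 2 ^ bitLen' k (suc n) ≤ 2 * suc n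
bitLen'-lower {suc zero}    {zero}  _          = ≤-refl
bitLen'-lower {suc (suc k)} {zero}  _          = ≤-refl
bitLen'-lower {suc k}       {suc n} (s≤s n<k) =
  *-monoʳ-≤ 2 (≤-trans (bitLen'-lower (≤-trans (s≤s (⌊n/2⌋≤n n)) n<k)) (2*⌊n/2⌋≤n (suc (suc n))))

∣∣ᵇ-upper : ∀ x → x < 2 ^ ∣ x ∣ᵇ
∣∣ᵇ-upper x = bitLen'-upper ≤-refl

∣suc∣ᵇ-lower : ∀ x → 2 ^ ∣ suc x ∣ᵇ ≤ 2 * suc x
∣suc∣ᵇ-lower x = bitLen'-lower ≤-refl

2^∣∣ᵇ≤2*suc : ∀ x → 2 ^ ∣ x ∣ᵇ ≤ 2 * suc x
2^∣∣ᵇ≤2*suc zero    = s≤s z≤n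
2^∣∣ᵇ≤2*suc (suc x) = ≤-trans (∣suc∣ᵇ-lower x) (*-monoʳ-≤ 2 (n≤1+n (suc x)))

2^b≤2*x<2^a⇒b≤a : ∀ {a b x} → 2 ^ b ≤ 2 * x → x < 2 ^ a → b ≤ a
2^b≤2*x<2^a⇒b≤a 2^b≤2x x<2^a =
  ≮⇒≥ λ a<b → <⇒≱ x<2^a (*-cancelˡ-≤ 2 (≤-trans (^-monoʳ-≤ 2 a<b) 2^b≤2x))

∣suc∣ᵇ-unique : ∀ {x k} → suc x < 2 ^ k → 2 ^ k ≤ 2 * suc x → ∣ suc x ∣ᵇ ≡ k
∣suc∣ᵇ-unique {x} upper lower =
  ≤-antisym (2^b≤2*x<2^a⇒b≤a (∣suc∣ᵇ-lower x) upper) (2^b≤2*x<2^a⇒b≤a lower (∣∣ᵇ-upper (suc x)))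

∣∣ᵇ-ladderStep : ∀ x → LadderStep ∣_∣ᵇ (λ i → 2 ^ i ∸ 1) x
∣∣ᵇ-ladderStep x with m≤n⇒m<n∨m≡n (∣∣ᵇ-upper x)
... | inj₁ 1+x<2^k = stay (∣suc∣ᵇ-unique 1+x<2^k (2^∣∣ᵇ≤2*suc x))
... | inj₂ 1+x≡2^k = climb (∣suc∣ᵇ-unique 1+x<2^[1+k] (≤-reflexive 2^[1+k]≡2*[1+x])) (cong (_∸ 1) 1+x≡2^k)
  where
  2^[1+k]≡2*[1+x] : 2 ^ suc ∣ x ∣ᵇ ≡ 2 * suc x
  2^[1+k]≡2*[1+x] = cong (2 *_) (sym 1+x≡2^k)
  1+x<2^[1+k] : suc x < 2 ^ suc ∣ x ∣ᵇ
  1+x<2^[1+k] = <-≤-trans (m<m+n (suc x) z<s) (≤-reflexive (sym 2^[1+k]≡2*[1+x]))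

mainTheorem13 : (p d : ℕ)
    (f : ℕ → Vec ℕ p → Vec ℤ d)
    (h : Vec ℤ d → ℕ → Vec ℕ p → Vec ℤ d) →
    (∀ x y → f (suc x) y ≡ f x y +ᵥ (((+ ∣ suc x ∣ᵇ) - (+ ∣ x ∣ᵇ)) ·ᵥ h (f x y) x y)) →
    ∀ x y → f x y ≡ f 0 y +ᵥ vsum ∣ x ∣ᵇ (λ i → h (f (2 ^ i ∸ 1) y) (2 ^ i ∸ 1) y)
mainTheorem13 p d f h rec x y =
  telescope-ladder refl ∣∣ᵇ-ladderStep (λ x → f x y) (λ x → h (f x y) x y) (λ x → rec x y) x
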